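{- Let $R$ be an ROBDD (with respect to a fixed total order $\prec$ on the variables) representing a Boolean function whose set of models is a vector space (contains the all-zero valuation and is closed under bitwise exclusive or). Then every path from the root node of $R$ to the $1$-sink visits the same sequence of variables, namely the elements of $\mathrm{vars}(R)$ listed in increasing $\prec$-order.
   Context: Binary decision diagrams (BDDs) are defined inductively: $0$ and $1$ are BDDs (sinks), and if $x$ is a variable and $R_1,R_2$ are BDDs then $\mathrm{ite}(x,R_1,R_2)$ is a BDD, with meaning $[\![\mathrm{ite}(x,R_1,R_2)]\!]=(x\wedge[\![R_1]\!])\vee(\neg x\wedge[\![R_2]\!])$, $[\![0]\!]=\mathit{false}$, $[\![1]\!]=\mathit{true}$. A BDD $R'$ appears in $R$ if $R'=R$ or $R'$ appears in a child of $R$. $\mathrm{vars}(R)$ is the set of variables $v$ such that some node $\mathrm{ite}(v,\_,\_)$ appears in $R$. An OBDD is a BDD in which for every node $\mathrm{ite}(x,R_1,R_2)$, $x\prec x'$ for all $x'\in\mathrm{vars}(R_1)\cup\mathrm{vars}(R_2)$. An ROBDD is an OBDD $R$ such that any two BDDs appearing in $R$ with the same meaning are identical (in particular no node has two identical children). A path from the root to the $1$-sink follows, at each node $\mathrm{ite}(x,R_1,R_2)$, either the edge to $R_1$ or to $R_2$. -}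

module Defs where

open import Level using (Level; _⊔_)
open import Data.Bool using (Bool; true; false; if_then_else_; _xor_)
open import Data.List using (List; []; _∷_)
open import Data.Sum using (_⊎_)
open import Relation.Binary.PropositionalEquality using (_≡_)

private variable a ℓ : Level

-- Binary decision diagrams over a type V of variables.
-- ite x R₁ R₂ : R₁ is the "x = true" child, R₂ the "x = false" child.
data BDD (V : Set a) : Set a where
  𝟘 𝟙 : BDD V
  ite : V → BDD V → BDD V → BDD V

module _ {V : Set a} where

  Valuation : Set a
  Valuation = V → Bool

  ⟦_⟧ : BDD V → Valuation → Bool
  ⟦ 𝟘 ⟧ ρ = false
  ⟦ 𝟙 ⟧ ρ = true
  ⟦ ite x R₁ R₂ ⟧ ρ = if ρ x then ⟦ R₁ ⟧ ρ else ⟦ R₂ ⟧ ρ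

  _⊨_ : Valuation → BDD V → Set
  ρ ⊨ R = ⟦ R ⟧ ρ ≡ true

  _≋_ : BDD V → BDD V → Set a
  R ≋ S = ∀ ρ → ⟦ R ⟧ ρ ≡ ⟦ S ⟧ ρ

  data _appearsIn_ : BDD V → BDD V → Set a where
    here  : ∀ {R} → R appearsIn R
    left  : ∀ {R' x R₁ R₂} → R' appearsIn R₁ → R' appearsIn ite x R₁ R₂
    right : ∀ {R' x R₁ R₂} → R' appearsIn R₂ → R' appearsIn ite x R₁ R₂

  _∈vars_ : V → BDD V → Set a
  v ∈vars R = ∃ite
    where
      ∃ite : Set a
      ∃ite = Data.Product.Σ (BDD V) (λ R₁ → Data.Product.Σ (BDD V) (λ R₂ → ite v R₁ R₂ appearsIn R))
        where import Data.Product

  IsOBDD : (V → V → Set ℓ) → BDD V → Set (a ⊔ ℓ)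
  IsOBDD _≺_ R = ∀ {x R₁ R₂} → ite x R₁ R₂ appearsIn R →
                 ∀ {x'} → (x' ∈vars R₁ ⊎ x' ∈vars R₂) → x ≺ x'

  IsROBDD : (V → V → Set ℓ) → BDD V → Set (a ⊔ ℓ)
  IsROBDD _≺_ R = IsOBDD _≺_ R Data.Product.×
                  (∀ {S T} → S appearsIn R → T appearsIn R → S ≋ T → S ≡ T)
    where import Data.Product

  data PathTo1 : BDD V → List V → Set a where
    sink  : PathTo1 𝟙 []
    hi    : ∀ {x R₁ R₂ xs} → PathTo1 R₁ xs → PathTo1 (ite x R₁ R₂) (x ∷ xs)
    lo    : ∀ {x R₁ R₂ xs} → PathTo1 R₂ xs → PathTo1 (ite x R₁ R₂) (x ∷ xs)

  ModelsVectorSpace : BDD V → Set a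
  ModelsVectorSpace R = Data.Product._×_ ((λ _ → false) ⊨ R)
                          (∀ ρ σ → ρ ⊨ R → σ ⊨ R → (λ v → ρ v xor σ v) ⊨ R)
    where import Data.Product

-- A path to 1 that skips a variable v yields two models differing exactly at v; their
-- sum is the unit vector at v, so by xor-closure flipping v preserves models and the
-- function does not depend on v. In an ROBDD no such variable occurs: a node ignoring its
-- own variable would have equivalent children, which reduction forbids, and independence
-- of v is inherited by the cofactors of every node labelled differently. So every path
-- visits all of vars(R), and ordering makes it visit them in increasing order.
module Submission where

open import Defs
open import Level using (Level)
open import Data.Bool using (Bool; true; false; if_then_else_; _xor_)
open import Data.Bool.Properties using (xor-assoc; xor-same; xor-identityʳ; ⇔→≡)
open import Data.Empty using (⊥-elim)
open import Data.List using (List; []; _∷_; head)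
open import Data.List.Membership.Propositional using (_∈_; _∉_)
import Data.List.Membership.DecPropositional as DecMembership
open import Data.List.Relation.Unary.Any using (here; there)
open import Data.List.Relation.Unary.Linked using (Linked; []; _∷′_)
open import Data.Maybe using (just)
open import Data.Maybe.Relation.Binary.Connected using (Connected; just; just-nothing)
open import Data.Product using (_×_; _,_; proj₁)
open import Data.Sum using (inj₁; inj₂)
open import Function using (_∘_)
open import Function.Bundles using (_⇔_; mk⇔)
open import Relation.Nullary using (¬_; yes; no; does)
open import Relation.Nullary.Decidable using (dec-true; dec-false; decidable-stable)
open import Relation.Binary.Definitions using (DecidableEquality; Irreflexive)
open import Relation.Binary.Structures using (IsStrictTotalOrder)
open import Relation.Binary.PropositionalEquality
  using (_≡_; _≢_; _≗_; refl; sym; trans; cong; cong₂; module ≡-Reasoning)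

module _ {a} {V : Set a} where

  ∈vars-child : ∀ {v x : V} {A B} c → v ∈vars (if c then A else B) → v ∈vars ite x A B
  ∈vars-child true  (S , T , p) = S , T , left p
  ∈vars-child false (S , T , p) = S , T , right p

  appearsIn-child : ∀ {S} {x : V} {A B} c → S appearsIn (if c then A else B) → S appearsIn ite x A B
  appearsIn-child true  = left
  appearsIn-child false = right

  hi≢ite : ∀ {x} {A B : BDD V} → A ≢ ite x A B
  hi≢ite ()

  ite-redundant : ∀ {x} {A B : BDD V} → A ≋ B → ite x A B ≋ A
  ite-redundant {x} A≋B ρ with ρ x
  ... | true  = refl
  ... | false = sym (A≋B ρ)

  ⟦ite⟧-select : ∀ {x : V} {A B} {σ : Valuation} c → σ x ≡ c →
                 ⟦ ite x A B ⟧ σ ≡ ⟦ if c then A else B ⟧ σ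
  ⟦ite⟧-select true  σx≡c rewrite σx≡c = refl
  ⟦ite⟧-select false σx≡c rewrite σx≡c = refl

  ⟦⟧-cong : ∀ (R : BDD V) {ρ σ} → ρ ≗ σ → ⟦ R ⟧ ρ ≡ ⟦ R ⟧ σ
  ⟦⟧-cong 𝟘 _ = refl
  ⟦⟧-cong 𝟙 _ = refl
  ⟦⟧-cong (ite x A B) ρ≗σ rewrite ρ≗σ x | ⟦⟧-cong A ρ≗σ | ⟦⟧-cong B ρ≗σ = refl

  infixr 5 _⊕_

  _⊕_ : Valuation {V = V} → Valuation → Valuation
  (ρ ⊕ σ) v = ρ v xor σ v

  XorClosed : BDD V → Set a
  XorClosed R = ∀ ρ σ → ρ ⊨ R → σ ⊨ R → (ρ ⊕ σ) ⊨ R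

  PathTo1-⊆vars : ∀ {R xs} {v : V} → PathTo1 R xs → v ∈ xs → v ∈vars R
  PathTo1-⊆vars (hi {R₁ = A} {R₂ = B} _) (here refl) = A , B , here
  PathTo1-⊆vars (lo {R₁ = A} {R₂ = B} _) (here refl) = A , B , here
  PathTo1-⊆vars (hi P) (there v∈xs) = ∈vars-child true  (PathTo1-⊆vars P v∈xs)
  PathTo1-⊆vars (lo P) (there v∈xs) = ∈vars-child false (PathTo1-⊆vars P v∈xs)

  module _ {ℓ} {_≺_ : V → V → Set ℓ} where

    IsOBDD-child : ∀ {x : V} {A B} → IsOBDD _≺_ (ite x A B) → ∀ c → IsOBDD _≺_ (if c then A else B)
    IsOBDD-child ob c = ob ∘ appearsIn-child c

    IsROBDD-child : ∀ {x : V} {A B} → IsROBDD _≺_ (ite x A B) → ∀ c → IsROBDD _≺_ (if c then A else B)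
    IsROBDD-child (ob , red) c = IsOBDD-child ob c , λ S∈ T∈ → red (appearsIn-child c S∈) (appearsIn-child c T∈)

    IsOBDD-root≺ : ∀ {x y : V} {A B} → IsOBDD _≺_ (ite x A B) → ∀ c → y ∈vars (if c then A else B) → x ≺ y
    IsOBDD-root≺ ob true  = ob here ∘ inj₁
    IsOBDD-root≺ ob false = ob here ∘ inj₂

    root≺head : ∀ {x : V} {A B ys} → IsOBDD _≺_ (ite x A B) → ∀ c → PathTo1 (if c then A else B) ys →
                Connected _≺_ (just x) (head ys)
    root≺head {ys = []}    _  _ _ = just-nothing
    root≺head {ys = _ ∷ _} ob c P = just (IsOBDD-root≺ ob c (PathTo1-⊆vars P (here refl)))

    PathTo1-linked : ∀ {R : BDD V} {xs} → IsOBDD _≺_ R → PathTo1 R xs → Linked _≺_ xs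
    PathTo1-linked ob sink   = []
    PathTo1-linked ob (hi P) = root≺head ob true  P ∷′ PathTo1-linked (IsOBDD-child ob true)  P
    PathTo1-linked ob (lo P) = root≺head ob false P ∷′ PathTo1-linked (IsOBDD-child ob false) P

module _ {a} {V : Set a} (_≟_ : DecidableEquality V) where

  open DecMembership _≟_ using (_∈?_)

  infixl 6 _[_]≔_

  _[_]≔_ : Valuation {V = V} → V → Bool → Valuation
  (ρ [ v ]≔ b) w = if does (w ≟ v) then b else ρ w

  []≔-same : ∀ (ρ : Valuation) v b → (ρ [ v ]≔ b) v ≡ b
  []≔-same ρ v b = cong (if_then b else ρ v) (dec-true (v ≟ v) refl)

  []≔-other : ∀ (ρ : Valuation) {v w} b → w ≢ v → (ρ [ v ]≔ b) w ≡ ρ w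
  []≔-other ρ {v} {w} b w≢v = cong (if_then b else ρ w) (dec-false (w ≟ v) w≢v)

  []≔-self : ∀ (ρ : Valuation) v → ρ [ v ]≔ ρ v ≗ ρ
  []≔-self ρ v w with w ≟ v
  ... | yes refl = refl
  ... | no  _    = refl

  []≔-overwrite : ∀ (ρ : Valuation) v b c → ρ [ v ]≔ b [ v ]≔ c ≗ ρ [ v ]≔ c
  []≔-overwrite ρ v b c w with w ≟ v
  ... | yes refl = refl
  ... | no  _    = refl

  []≔-cong : ∀ {ρ σ : Valuation} v b → ρ ≗ σ → ρ [ v ]≔ b ≗ σ [ v ]≔ b
  []≔-cong v b ρ≗σ w = cong (if does (w ≟ v) then b else_) (ρ≗σ w)

  []≔-comm : ∀ (ρ : Valuation) {x v} b c → x ≢ v → ρ [ v ]≔ b [ x ]≔ c ≗ ρ [ x ]≔ c [ v ]≔ b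
  []≔-comm ρ {x} {v} b c x≢v w with w ≟ x | w ≟ v
  ... | yes refl | yes refl = ⊥-elim (x≢v refl)
  ... | yes refl | no  _    = refl
  ... | no  _    | yes refl = refl
  ... | no  _    | no  _    = refl

  ⊕-[]≔ : ∀ (σ ρ : Valuation) v b c → σ ⊕ ρ [ v ]≔ b ⊕ ρ [ v ]≔ c ≗ σ [ v ]≔ (σ v xor (b xor c))
  ⊕-[]≔ σ ρ v b c w with w ≟ v
  ... | yes refl = refl
  ... | no  _    = trans (cong (σ w xor_) (xor-same (ρ w))) (xor-identityʳ (σ w))

  IndependentOf : V → BDD V → Set a
  IndependentOf v R = ∀ ρ b → ⟦ R ⟧ (ρ [ v ]≔ b) ≡ ⟦ R ⟧ ρ

  ∉vars⇒independent : ∀ {v} (R : BDD V) → ¬ v ∈vars R → IndependentOf v R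
  ∉vars⇒independent 𝟘 _ _ _ = refl
  ∉vars⇒independent 𝟙 _ _ _ = refl
  ∉vars⇒independent (ite x A B) v∉R ρ b =
    trans (cong (if_then _ else _) ([]≔-other ρ b λ { refl → v∉R (A , B , here) }))
          (cong₂ (if ρ x then_else_) (∉vars⇒independent A (v∉R ∘ ∈vars-child true)  ρ b)
                                     (∉vars⇒independent B (v∉R ∘ ∈vars-child false) ρ b))

  XorClosed-[]≔ : ∀ R {ρ v} → XorClosed R → (∀ b → (ρ [ v ]≔ b) ⊨ R) →
                  ∀ {σ} → σ ⊨ R → ∀ c → (σ [ v ]≔ c) ⊨ R
  XorClosed-[]≔ R {ρ} {v} closed ρ[v]⊨R {σ} σ⊨R c = begin
    ⟦ R ⟧ (σ [ v ]≔ c)                         ≡⟨ cong (λ d → ⟦ R ⟧ (σ [ v ]≔ d)) (sym xor-cancel) ⟩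
    ⟦ R ⟧ (σ [ v ]≔ (σ v xor (σ v xor c)))     ≡⟨ ⟦⟧-cong R (⊕-[]≔ σ ρ v (σ v) c) ⟨
    ⟦ R ⟧ (σ ⊕ ρ [ v ]≔ σ v ⊕ ρ [ v ]≔ c)      ≡⟨ closed _ _ σ⊨R (closed _ _ (ρ[v]⊨R (σ v)) (ρ[v]⊨R c)) ⟩
    true                                       ∎
    where
    open ≡-Reasoning
    xor-cancel : σ v xor (σ v xor c) ≡ c
    xor-cancel = trans (sym (xor-assoc (σ v) (σ v) c)) (cong (_xor c) (xor-same (σ v)))

  XorClosed⇒independent : ∀ R {ρ v} → XorClosed R → (∀ b → (ρ [ v ]≔ b) ⊨ R) → IndependentOf v R
  XorClosed⇒independent R {ρ} {v} closed ρ[v]⊨R σ b = ⇔→≡ (mk⇔ restore (λ σ⊨R → update σ⊨R b))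
    where
    update : ∀ {σ} → σ ⊨ R → ∀ c → (σ [ v ]≔ c) ⊨ R
    update = XorClosed-[]≔ R closed ρ[v]⊨R
    restore : (σ [ v ]≔ b) ⊨ R → σ ⊨ R
    restore σ[v]⊨R = trans (⟦⟧-cong R λ w → sym (trans ([]≔-overwrite σ v b (σ v) w) ([]≔-self σ v w)))
                           (update σ[v]⊨R (σ v))

  follow : ∀ {R : BDD V} {xs} → PathTo1 R xs → Valuation {V = V} → Valuation
  follow sink       σ = σ
  follow (hi {x} P) σ = follow P σ [ x ]≔ true
  follow (lo {x} P) σ = follow P σ [ x ]≔ false

  follow-[]≔ : ∀ {R : BDD V} {xs v} (P : PathTo1 R xs) → v ∉ xs →
               ∀ σ b → follow P (σ [ v ]≔ b) ≗ follow P σ [ v ]≔ b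
  follow-[]≔ sink       _    σ b w = refl
  follow-[]≔ (hi {x} P) v∉xs σ b w =
    trans ([]≔-cong x true (follow-[]≔ P (v∉xs ∘ there) σ b) w)
          ([]≔-comm (follow P σ) b true (v∉xs ∘ here ∘ sym) w)
  follow-[]≔ (lo {x} P) v∉xs σ b w =
    trans ([]≔-cong x false (follow-[]≔ P (v∉xs ∘ there) σ b) w)
          ([]≔-comm (follow P σ) b false (v∉xs ∘ here ∘ sym) w)

  module _ {ℓ} {_≺_ : V → V → Set ℓ} (irrefl : Irreflexive _≡_ _≺_) where
    open ≡-Reasoning

    root∉vars-child : ∀ {x : V} {A B} → IsOBDD _≺_ (ite x A B) → ∀ c → ¬ x ∈vars (if c then A else B)
    root∉vars-child ob c = irrefl refl ∘ IsOBDD-root≺ ob c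

    cofactor : ∀ {x : V} {A B} → IsOBDD _≺_ (ite x A B) →
               ∀ c ρ → ⟦ if c then A else B ⟧ ρ ≡ ⟦ ite x A B ⟧ (ρ [ x ]≔ c)
    cofactor {x} {A} {B} ob c ρ = begin
      ⟦ if c then A else B ⟧ ρ              ≡⟨ ∉vars⇒independent (if c then A else B) (root∉vars-child ob c) ρ c ⟨
      ⟦ if c then A else B ⟧ (ρ [ x ]≔ c)   ≡⟨ ⟦ite⟧-select c ([]≔-same ρ x c) ⟨
      ⟦ ite x A B ⟧ (ρ [ x ]≔ c)            ∎

    IndependentOf-child : ∀ {x v : V} {A B} → IsOBDD _≺_ (ite x A B) → x ≢ v →
                          IndependentOf v (ite x A B) → ∀ c → IndependentOf v (if c then A else B)
    IndependentOf-child {x} {v} {A} {B} ob x≢v ind c ρ b = begin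
      ⟦ if c then A else B ⟧ (ρ [ v ]≔ b)   ≡⟨ cofactor ob c _ ⟩
      ⟦ ite x A B ⟧ (ρ [ v ]≔ b [ x ]≔ c)   ≡⟨ ⟦⟧-cong (ite x A B) ([]≔-comm ρ b c x≢v) ⟩
      ⟦ ite x A B ⟧ (ρ [ x ]≔ c [ v ]≔ b)   ≡⟨ ind _ b ⟩
      ⟦ ite x A B ⟧ (ρ [ x ]≔ c)            ≡⟨ cofactor ob c ρ ⟨
      ⟦ if c then A else B ⟧ ρ              ∎

    cofactors-≋ : ∀ {x : V} {A B} → IsOBDD _≺_ (ite x A B) → IndependentOf x (ite x A B) → A ≋ B
    cofactors-≋ {x} {A} {B} ob ind ρ = begin
      ⟦ A ⟧ ρ                          ≡⟨ cofactor ob true ρ ⟩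
      ⟦ ite x A B ⟧ (ρ [ x ]≔ true)    ≡⟨ ind ρ true ⟩
      ⟦ ite x A B ⟧ ρ                  ≡⟨ ind ρ false ⟨
      ⟦ ite x A B ⟧ (ρ [ x ]≔ false)   ≡⟨ cofactor ob false ρ ⟨
      ⟦ B ⟧ ρ                          ∎

    root-¬independent : ∀ {x : V} {A B} → IsROBDD _≺_ (ite x A B) → ¬ IndependentOf x (ite x A B)
    root-¬independent {A = A} {B} (ob , reduced) ind =
      hi≢ite (sym (reduced here (left here) (ite-redundant {A = A} {B} (cofactors-≋ ob ind))))

    independent⇒∉vars : ∀ {v} (R : BDD V) → IsROBDD _≺_ R → IndependentOf v R → ¬ v ∈vars R
    independent⇒∉vars 𝟘 _ _ (_ , _ , ())
    independent⇒∉vars 𝟙 _ _ (_ , _ , ())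
    independent⇒∉vars {v} (ite x A B) rob ind = λ where
        (_ , _ , here)    → root-¬independent rob ind
        (S , T , left  p) → independent⇒∉vars A (IsROBDD-child rob true)
                              (IndependentOf-child (proj₁ rob) x≢v ind true) (S , T , p)
        (S , T , right p) → independent⇒∉vars B (IsROBDD-child rob false)
                              (IndependentOf-child (proj₁ rob) x≢v ind false) (S , T , p)
      where
      x≢v : x ≢ v
      x≢v refl = root-¬independent rob ind

    follow-⊨ : ∀ {R : BDD V} {xs} → IsOBDD _≺_ R → (P : PathTo1 R xs) → ∀ σ → follow P σ ⊨ R
    follow-⊨ ob sink   σ = refl
    follow-⊨ ob (hi P) σ = trans (sym (cofactor ob true  (follow P σ))) (follow-⊨ (IsOBDD-child ob true)  P σ)
    follow-⊨ ob (lo P) σ = trans (sym (cofactor ob false (follow P σ))) (follow-⊨ (IsOBDD-child ob false) P σ)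

    ∉PathTo1⇒independent : ∀ {R : BDD V} {xs v} → XorClosed R → IsOBDD _≺_ R →
                           PathTo1 R xs → v ∉ xs → IndependentOf v R
    ∉PathTo1⇒independent {R} {v = v} closed ob P v∉xs = XorClosed⇒independent R closed ρ[v]⊨R
      where
      σ : Valuation {V = V}
      σ _ = false
      ρ[v]⊨R : ∀ b → (follow P σ [ v ]≔ b) ⊨ R
      ρ[v]⊨R b = trans (sym (⟦⟧-cong R (follow-[]≔ P v∉xs σ b))) (follow-⊨ ob P (σ [ v ]≔ b))

    ∈vars⇒∈PathTo1 : ∀ {R : BDD V} {xs v} → IsROBDD _≺_ R → XorClosed R →
                     PathTo1 R xs → v ∈vars R → v ∈ xs
    ∈vars⇒∈PathTo1 {R} {xs} {v} rob closed P v∈R = decidable-stable (v ∈? xs) λ v∉xs →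
      independent⇒∉vars R rob (∉PathTo1⇒independent closed (proj₁ rob) P v∉xs) v∈R

corollary1 : ∀ {a ℓ : Level} {V : Set a} (_≺_ : V → V → Set ℓ) →
    IsStrictTotalOrder _≡_ _≺_ →
    (R : BDD V) →
    IsROBDD _≺_ R →
    ModelsVectorSpace R →
    ∀ {xs : List V} → PathTo1 R xs →
    Linked _≺_ xs × (∀ v → (v ∈ xs) ⇔ (v ∈vars R))
corollary1 _≺_ sto R rob (_ , closed) P =
  PathTo1-linked (proj₁ rob) P , λ v → mk⇔ (PathTo1-⊆vars P) (∈vars⇒∈PathTo1 _≟_ irrefl rob closed P)
  where open IsStrictTotalOrder sto using (_≟_; irrefl)
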